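{- Let $\sigma$ be a 2-structure and let $X\subsetneq V(\sigma)$ be such that $\sigma[X]$ is prime. Suppose that Statement (S3) holds (there is no $3$-element $Y\subseteq\overline{X}$ with $\sigma[X\cup Y]$ prime), and that $\sigma$ is prime. Then: (1) Let $e\in E(\sigma)$. If $|\langle X\rangle_\sigma^{(e,e)}|\geq 2$, then $\sigma[\langle X\rangle_\sigma]$ is constant and $E(\sigma[\langle X\rangle_\sigma])=\{e[\langle X\rangle_\sigma]\}$. Similarly, for $\alpha\in X$, if $|X_\sigma^{(e,e)}(\alpha)|\geq 2$, then $\sigma[X_\sigma(\alpha)]$ is constant and $E(\sigma[X_\sigma(\alpha)])=\{e[X_\sigma(\alpha)]\}$. (2) Let $e,f\in E(\sigma)$ be distinct. If $|\langle X\rangle_\sigma^{(e,f)}|\geq 2$, then $\sigma[\langle X\rangle_\sigma]$ is linear and $E(\sigma[\langle X\rangle_\sigma])=\{e[\langle X\rangle_\sigma],f[\langle X\rangle_\sigma]\}$. Similarly, for $\alpha\in X$, if $|X_\sigma^{(e,f)}(\alpha)|\geq 2$, then $\sigma[X_\sigma(\alpha)]$ is linear and $E(\sigma[X_\sigma(\alpha)])=\{e[X_\sigma(\alpha)],f[X_\sigma(\alpha)]\}$.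
   Context: A 2-structure $\sigma$ consists of a vertex set $V(\sigma)$ and an equivalence relation $\equiv_\sigma$ on the set of ordered pairs $(u,v)$ of distinct elements of $V(\sigma)$; $E(\sigma)$ is the set of its equivalence classes, and $(v,w)_\sigma$ denotes the class of $(v,w)$; $[v,w]_\sigma=((v,w)_\sigma,(w,v)_\sigma)$. For $W\subseteq V(\sigma)$, $\sigma[W]$ is the 2-structure on $W$ with the restricted equivalence relation, and for $e\in E(\sigma)$, $e[W]=e\cap(W\times W)$. $\overline{X}=V(\sigma)\setminus X$. A subset $M\subseteq V(\sigma)$ is a module of $\sigma$ if for all $x,y\in M$ and $v\in V(\sigma)\setminus M$, $(x,v)\equiv_\sigma(y,v)$ and $(v,x)\equiv_\sigma(v,y)$; $\emptyset$, $V(\sigma)$ and singletons are trivial modules. $\sigma$ is prime if $|V(\sigma)|\geq 3$ and all its modules are trivial. A 2-structure $\tau$ is constant if $|E(\tau)|=1$, and linear if there exist distinct $e,f\in E(\tau)$ such that the relation $\{(v,w): v\neq w,\ [v,w]_\tau=(e,f)\}$ is a (strict) linear order on $V(\tau)$. For $X\subsetneq V(\sigma)$ with $\sigma[X]$ prime: $\langle X\rangle_\sigma$ is the set of $v\in\overline{X}$ such that $X$ is a module of $\sigma[X\cup\{v\}]$; for $\alpha\in X$, $X_\sigma(\alpha)$ is the set of $v\in\overline{X}$ such that $\{\alpha,v\}$ is a module of $\sigma[X\cup\{v\}]$. For $e,f\in E(\sigma)$: $\langle X\rangle_\sigma^{(e,f)}$ is the set of $v\in\langle X\rangle_\sigma$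 with $(v,\beta)\in e$ and $(\beta,v)\in f$ for $\beta\in X$ (independent of $\beta$); for $\alpha\in X$, $X_\sigma^{(e,f)}(\alpha)$ is the set of $v\in X_\sigma(\alpha)$ with $(v,\alpha)\in e$ and $(\alpha,v)\in f$. -}

module Defs where

open import Data.Product using (Σ; ∃; _×_; _,_)
open import Data.Sum using (_⊎_)
open import Data.Unit using (⊤)
open import Relation.Nullary using (¬_)
open import Relation.Binary.PropositionalEquality using (_≡_; _≢_)
open import Function.Bundles using (_⇔_)

Sub : Set → Set₁
Sub V = V → Set

Rel₂ : Set → Set₁
Rel₂ V = V → V → Set

-- A 2-structure on vertex set V: an equivalence relation on the ordered pairs
-- of DISTINCT vertices.  R x y u v  means  (x,y) ≡σ (u,v).
record TwoStructure (V : Set) : Set₁ where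
  field
    R       : V → V → V → V → Set
    R-dist  : ∀ {x y u v} → R x y u v → (x ≢ y) × (u ≢ v)
    R-refl  : ∀ {x y} → x ≢ y → R x y x y
    R-sym   : ∀ {x y u v} → R x y u v → R u v x y
    R-trans : ∀ {x y u v s t} → R x y u v → R u v s t → R x y s t

module _ {V : Set} (σ : TwoStructure V) where
  open TwoStructure σ

  full : Sub V
  full _ = ⊤

  _∪₁_ : Sub V → V → Sub V
  (X ∪₁ v) w = X w ⊎ w ≡ v

  IsModule : Sub V → Sub V → Set
  IsModule W M =
    (∀ x → M x → W x) ×
    (∀ x y v → M x → M y → W v → ¬ M v → R x v y v × R v x v y)

  Trivial : Sub V → Sub V → Set
  Trivial W M =
    (∀ x → ¬ M x) ⊎ ((∀ x → W x → M x) ⊎ (∃ λ a → ∀ x → M x ⇔ (x ≡ a)))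

  Prime : Sub V → Set₁
  Prime W =
    (∃ λ a → ∃ λ b → ∃ λ c → W a × W b × W c × a ≢ b × a ≢ c × b ≢ c) ×
    (∀ (M : Sub V) → IsModule W M → Trivial W M)

  IsClass : Sub V → Rel₂ V → Set
  IsClass W c = ∃ λ x → ∃ λ y → W x × W y × x ≢ y ×
    (∀ u v → c u v ⇔ (W u × W v × R u v x y))

  Same : Rel₂ V → Rel₂ V → Set
  Same c d = ∀ u v → c u v ⇔ d u v

  restrict : Rel₂ V → Sub V → Rel₂ V
  restrict e W u v = W u × W v × e u v

  AtLeast2 : Sub V → Set
  AtLeast2 S = ∃ λ a → ∃ λ b → a ≢ b × S a × S b

  Constant : Sub V → Set₁
  Constant W = ∃ λ (c : Rel₂ V) → IsClass W c × (∀ d → IsClass W d → Same c d)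

  StrictLinearOn : Sub V → Rel₂ V → Set
  StrictLinearOn W _<_ =
    (∀ x → W x → ¬ (x < x)) ×
    (∀ x y z → W x → W y → W z → x < y → y < z → x < z) ×
    (∀ x y → W x → W y → x ≢ y → (x < y) ⊎ (y < x))

  Linear : Sub V → Set₁
  Linear W = ∃ λ (e : Rel₂ V) → ∃ λ (f : Rel₂ V) →
    IsClass W e × IsClass W f × ¬ Same e f ×
    StrictLinearOn W (λ v w → v ≢ w × e v w × f w v)

  ClassesAre₁ : Sub V → Rel₂ V → Set₁
  ClassesAre₁ W e = ∀ (c : Rel₂ V) → IsClass W c ⇔ Same c (restrict e W)

  ClassesAre₂ : Sub V → Rel₂ V → Rel₂ V → Set₁
  ClassesAre₂ W e f = ∀ (c : Rel₂ V) →
    IsClass W c ⇔ (Same c (restrict e W) ⊎ Same c (restrict f W))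

  Ext : Sub V → Sub V
  Ext X v = ¬ X v × IsModule (X ∪₁ v) X

  XAt : Sub V → V → Sub V
  XAt X α v = ¬ X v × IsModule (X ∪₁ v) (λ w → w ≡ α ⊎ w ≡ v)

  ExtEF : Sub V → Rel₂ V → Rel₂ V → Sub V
  ExtEF X e f v = Ext X v × (∀ β → X β → e v β × f β v)

  XAtEF : Sub V → V → Rel₂ V → Rel₂ V → Sub V
  XAtEF X α e f v = XAt X α v × e v α × f α v

  S3 : Sub V → Set₁
  S3 X = ¬ (∃ λ y₁ → ∃ λ y₂ → ∃ λ y₃ →
    ¬ X y₁ × ¬ X y₂ × ¬ X y₃ × y₁ ≢ y₂ × y₁ ≢ y₃ × y₂ ≢ y₃ ×
    Prime (λ w → X w ⊎ (w ≡ y₁ ⊎ (w ≡ y₂ ⊎ w ≡ y₃))))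

module Submission where

open import Defs
open import Axiom.ExcludedMiddle using (ExcludedMiddle)
open import Axiom.DoubleNegationElimination using (em⇒dne)
open import Data.Empty using (⊥; ⊥-elim)
open import Data.Product using (∃; _×_; _,_; proj₁; proj₂)
open import Data.Sum using (_⊎_; inj₁; inj₂)
import Data.Sum as Sum
open import Data.Unit using (tt)
open import Function.Base using (_∘_)
open import Function.Bundles using (_⇔_; mk⇔; Equivalence)
open import Level using (0ℓ)
open import Relation.Nullary using (¬_; yes; no)
open import Relation.Binary.PropositionalEquality using (_≡_; _≢_; refl; sym; trans; subst)

open Equivalence using (to; from)

-- Primality of X makes the argument classical (prime⇒em).  Let Y be ⟨X⟩ or X(α), with
-- reference vertex b ∈ X (b = α for X(α)), and call d linked to y ∈ Y when [y,d] ≅ [y,b]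
-- (resp. [d,y] ≅ [d,α]).  Given distinct y, y' ∈ Y and d outside X ∪ Y,
-- (S3) says σ[X ∪ {y, y', d}] is not prime; as σ[X] is prime, a module of it meets X in
-- ∅, X or a single vertex, and going through the few cases shows: if d is not linked to y,
-- then either [y,b] ≅ [y',b] and d does not distinguish y from y', or y' is linked to y
-- and to d.  Writing y ⊏ y' when some d is linked to y' but not to y, this gives
-- [y',y] ≅ [y',b] whenever y ⊏ y', and primality of σ makes ⊏ connex on Y: the vertices
-- that ⊏ does not separate from y would form a module.  Fix a ∈ Y whose pair with b lies
-- in (e,f).  Then every pair of distinct vertices of Y is ≅ [a,b] or [b,a]; if e = f this
-- makes σ[Y] constant, and otherwise [u,w] ≅ [a,b] is a strict linear order on Y.

-- Sub V = V → Set lets any proposition P be encoded as the module {a | P} of σ[W];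
-- its triviality decides P.
prime⇒em : ∀ {V} (σ : TwoStructure V) {W : Sub V} → Prime σ W → ExcludedMiddle 0ℓ
prime⇒em σ {W} ((a , _ , _ , Wa , _) , trivial) {P} with trivial (λ x → x ≡ a × P) point-if-P
  where
  open TwoStructure σ
  point-if-P : IsModule σ W (λ x → x ≡ a × P)
  point-if-P = (λ { _ (refl , _) → Wa })
             , λ { _ _ _ (refl , p) (refl , _) _ v∉ → R-refl (λ v≡a → v∉ (sym v≡a , p))
                                                    , R-refl (λ a≡v → v∉ (a≡v , p)) }
... | inj₁ empty              = no λ p → empty a (refl , p)
... | inj₂ (inj₁ whole)       = yes (proj₂ (whole a Wa))
... | inj₂ (inj₂ (z , point)) = yes (proj₂ (from (point z) refl))

module _ {V : Set} (σ : TwoStructure V) where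
  open TwoStructure σ

  [_,_]≅[_,_] : V → V → V → V → Set
  [ a , b ]≅[ u , v ] = R a b u v × R b a v u

  infixr 5 _∙_

  ≅-refl : ∀ {a b} → a ≢ b → [ a , b ]≅[ a , b ]
  ≅-refl a≢b = R-refl a≢b , R-refl (a≢b ∘ sym)

  ≅-sym : ∀ {a b u v} → [ a , b ]≅[ u , v ] → [ u , v ]≅[ a , b ]
  ≅-sym (p , q) = R-sym p , R-sym q

  ≅-flip : ∀ {a b u v} → [ a , b ]≅[ u , v ] → [ b , a ]≅[ v , u ]
  ≅-flip (p , q) = q , p

  _∙_ : ∀ {a b u v s t} → [ a , b ]≅[ u , v ] → [ u , v ]≅[ s , t ] → [ a , b ]≅[ s , t ]
  (p , q) ∙ (p' , q') = R-trans p p' , R-trans q q'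

  ≅-distinct : ∀ {a b u v} → [ a , b ]≅[ u , v ] → a ≢ b
  ≅-distinct (p , _) = proj₁ (R-dist p)

  prime⇒no-proper-module : Prime σ (full σ) → (M : Sub V) →
    (∀ {x y v} → M x → M y → ¬ M v → [ x , v ]≅[ y , v ]) →
    ∀ {x y z} → M x → M y → x ≢ y → ¬ M z → ⊥
  prime⇒no-proper-module (_ , trivial) M uniform Mx My x≢y z∉M
    with trivial M ((λ _ _ → tt) , λ _ _ _ Mx My _ v∉M → uniform Mx My v∉M)
  ... | inj₁ empty              = empty _ Mx
  ... | inj₂ (inj₁ whole)       = z∉M (whole _ tt)
  ... | inj₂ (inj₂ (_ , point)) = x≢y (trans (to (point _) Mx) (sym (to (point _) My)))

  Same-sym : ∀ {c d} → Same σ c d → Same σ d c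
  Same-sym c≡d u v = mk⇔ (from (c≡d u v)) (to (c≡d u v))

  IsClass-resp-Same : ∀ {W c d} → IsClass σ W c → Same σ c d → IsClass σ W d
  IsClass-resp-Same (x , y , Wx , Wy , x≢y , c-def) c≡d = x , y , Wx , Wy , x≢y , λ u v →
    mk⇔ (to (c-def u v) ∘ from (c≡d u v)) (to (c≡d u v) ∘ from (c-def u v))

  class-inhabited : ∀ {W c} → IsClass σ W c → ∃ λ u → ∃ λ v → W u × W v × u ≢ v × c u v
  class-inhabited (x , y , Wx , Wy , x≢y , c-def) =
    x , y , Wx , Wy , x≢y , from (c-def x y) (Wx , Wy , R-refl x≢y)

  module _ {e : Rel₂ V} (e-class : IsClass σ (full σ) e) where
    private
      x₀ y₀ : V
      x₀ = proj₁ e-class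
      y₀ = proj₁ (proj₂ e-class)
      e-def : ∀ u v → e u v ⇔ (full σ u × full σ v × R u v x₀ y₀)
      e-def = proj₂ (proj₂ (proj₂ (proj₂ (proj₂ e-class))))
      R-base : ∀ {u v} → e u v → R u v x₀ y₀
      R-base {u} {v} = proj₂ ∘ proj₂ ∘ to (e-def u v)

    class-R : ∀ {p q u v} → e p q → e u v → R u v p q
    class-R epq euv = R-trans (R-base euv) (R-sym (R-base epq))

    class-closed : ∀ {p q u v} → e p q → R u v p q → e u v
    class-closed {u = u} {v} epq r = from (e-def u v) (tt , tt , R-trans r (R-base epq))

    restriction-is-class : ∀ {W p q} → W p → W q → p ≢ q → e p q → IsClass σ W (restrict σ e W)
    restriction-is-class {p = p} {q} Wp Wq p≢q epq = p , q , Wp , Wq , p≢q , λ u v → mk⇔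
      (λ (Wu , Wv , euv) → Wu , Wv , class-R epq euv)
      (λ (Wu , Wv , r) → Wu , Wv , class-closed epq r)

    class-meeting-is-restriction : ∀ {W c u v} → IsClass σ W c → c u v → e u v →
      Same σ c (restrict σ e W)
    class-meeting-is-restriction {W} {c} (x , y , _ , _ , _ , c-def) cuv euv s t = mk⇔
      (λ cst → let (Ws , Wt , r) = to (c-def s t) cst in
               Ws , Wt , class-closed euv (R-trans r (R-sym (R-witness cuv))))
      (λ (Ws , Wt , est) → from (c-def s t) (Ws , Wt , R-trans (class-R euv est) (R-witness cuv)))
      where
      R-witness : ∀ {u v} → c u v → R u v x y
      R-witness {u} {v} cuv = proj₂ (proj₂ (to (c-def u v) cuv))

  sharing-a-pair⇒Same : ∀ {e f p q} → IsClass σ (full σ) e → IsClass σ (full σ) f →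
    e p q → f p q → Same σ e f
  sharing-a-pair⇒Same e-class f-class epq fpq u v = mk⇔
    (λ euv → class-closed f-class fpq (class-R e-class epq euv))
    (λ fuv → class-closed e-class epq (class-R f-class fpq fuv))

  module _ {W : Sub V} {p q : V} (Wp : W p) (Wq : W q) (p≢q : p ≢ q) where

    constant-of-class : ∀ {e} → IsClass σ (full σ) e →
      (∀ {u v} → W u → W v → u ≢ v → e u v) → Constant σ W × ClassesAre₁ σ W e
    constant-of-class {e} e-class all-in-e =
      (restrict σ e W , e[W]-class , λ c c-class → Same-sym (is-e[W] c-class)) ,
      λ c → mk⇔ is-e[W] (IsClass-resp-Same e[W]-class ∘ Same-sym)
      where
      e[W]-class : IsClass σ W (restrict σ e W)
      e[W]-class = restriction-is-class e-class Wp Wq p≢q (all-in-e Wp Wq p≢q)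
      is-e[W] : ∀ {c} → IsClass σ W c → Same σ c (restrict σ e W)
      is-e[W] c-class with class-inhabited c-class
      ... | (_ , _ , Wu , Wv , u≢v , cuv) =
        class-meeting-is-restriction e-class c-class cuv (all-in-e Wu Wv u≢v)

    two-classes : ∀ {e f} → IsClass σ (full σ) e → IsClass σ (full σ) f → e p q → f q p →
      (∀ {u v} → W u → W v → u ≢ v → e u v ⊎ f u v) → ClassesAre₂ σ W e f
    two-classes {e} {f} e-class f-class epq fqp e-or-f c = mk⇔ classify
      λ { (inj₁ c≡e) → IsClass-resp-Same e[W]-class (Same-sym c≡e)
        ; (inj₂ c≡f) → IsClass-resp-Same f[W]-class (Same-sym c≡f) }
      where
      e[W]-class : IsClass σ W (restrict σ e W)
      e[W]-class = restriction-is-class e-class Wp Wq p≢q epq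
      f[W]-class : IsClass σ W (restrict σ f W)
      f[W]-class = restriction-is-class f-class Wq Wp (p≢q ∘ sym) fqp
      classify : IsClass σ W c → Same σ c (restrict σ e W) ⊎ Same σ c (restrict σ f W)
      classify c-class with class-inhabited c-class
      ... | (_ , _ , Wu , Wv , u≢v , cuv) with e-or-f Wu Wv u≢v
      ...   | inj₁ euv = inj₁ (class-meeting-is-restriction e-class c-class cuv euv)
      ...   | inj₂ fuv = inj₂ (class-meeting-is-restriction f-class c-class cuv fuv)

  order⇒linear : ∀ {W e f} {_<_ : Rel₂ V} →
    IsClass σ (full σ) e → IsClass σ (full σ) f → ¬ Same σ e f → StrictLinearOn σ W _<_ →
    (∀ {u w} → u < w → e u w × f w u) → (∀ {u w} → e u w → f w u → u < w) →
    ∀ {p q} → W p → W q → p < q → Linear σ W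
  order⇒linear {W} {e} {f} {_<_} e-class f-class e≢f (irrefl , <-trans , <-connex) <⇒ef ef⇒<
               {p} {q} Wp Wq p<q =
    restrict σ e W , restrict σ f W ,
    restriction-is-class e-class Wp Wq (<⇒≢ Wp p<q) (proj₁ (<⇒ef p<q)) ,
    restriction-is-class f-class Wq Wp (<⇒≢ Wp p<q ∘ sym) (proj₂ (<⇒ef p<q)) ,
    (λ e≡f → e≢f (sharing-a-pair⇒Same e-class f-class (proj₁ (<⇒ef p<q))
                    (proj₂ (proj₂ (to (e≡f p q) (Wp , Wq , proj₁ (<⇒ef p<q))))))) ,
    (λ _ _ (x≢x , _) → x≢x refl) ,
    (λ _ _ _ Wx Wy Wz x⋖y y⋖z → related Wx Wz (<-trans _ _ _ Wx Wy Wz (back x⋖y) (back y⋖z))) ,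
    (λ _ _ Wx Wy x≢y → Sum.map (related Wx Wy) (related Wy Wx) (<-connex _ _ Wx Wy x≢y))
    where
    <⇒≢ : ∀ {x y} → W x → x < y → x ≢ y
    <⇒≢ Wx x<y refl = irrefl _ Wx x<y
    related : ∀ {x y} → W x → W y → x < y → x ≢ y × restrict σ e W x y × restrict σ f W y x
    related Wx Wy x<y = <⇒≢ Wx x<y , (Wx , Wy , proj₁ (<⇒ef x<y)) , (Wy , Wx , proj₂ (<⇒ef x<y))
    back : ∀ {x y} → x ≢ y × restrict σ e W x y × restrict σ f W y x → x < y
    back (_ , (_ , _ , exy) , (_ , _ , fyx)) = ef⇒< exy fyx

  -- Modules and the prime σ[X]

  module PrimeRestriction {X : Sub V} (prime-X : Prime σ X) where

    data Trace (M : Sub V) : Set where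
      disjoint : (∀ {x} → X x → ¬ M x) → Trace M
      covers   : (∀ {x} → X x → M x) → Trace M
      meets-at : ∀ {s} → X s → M s → (∀ {x} → X x → M x → x ≡ s) → Trace M

    trace : ∀ {W M} → (∀ {x} → X x → W x) → IsModule σ W M → Trace M
    trace {M = M} X⊆W (_ , uniform) with proj₂ prime-X (λ x → M x × X x)
        ((λ _ → proj₂) , λ x y v (Mx , _) (My , _) Xv v∉ →
                           uniform x y v Mx My (X⊆W Xv) (v∉ ∘ (_, Xv)))
    ... | inj₁ empty             = disjoint λ Xx Mx → empty _ (Mx , Xx)
    ... | inj₂ (inj₁ whole)      = covers λ Xx → proj₁ (whole _ Xx)
    ... | inj₂ (inj₂ (s , point)) =
      let (Ms , Xs) = from (point s) refl in meets-at Xs Ms λ Xx Mx → to (point _) (Mx , Xx)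

    module _ (em : ExcludedMiddle 0ℓ) where

      two-others : ∀ s → ∃ λ p → ∃ λ q → X p × X q × p ≢ q × p ≢ s × q ≢ s
      two-others s with proj₁ prime-X
      ... | (a , b , c , Xa , Xb , Xc , a≢b , a≢c , b≢c) with em {a ≡ s} | em {b ≡ s}
      ... | yes refl | _        = b , c , Xb , Xc , b≢c , a≢b ∘ sym , a≢c ∘ sym
      ... | no a≢s   | yes refl = a , c , Xa , Xc , a≢c , a≢s , b≢c ∘ sym
      ... | no a≢s   | no b≢s   = a , b , Xa , Xb , a≢b , a≢s , b≢s

      third-point : ∀ s t → ∃ λ v → X v × v ≢ s × v ≢ t
      third-point s t with two-others s
      ... | (p , q , Xp , Xq , p≢q , p≢s , q≢s) with em {p ≡ t}
      ... | yes refl = q , Xq , q≢s , p≢q ∘ sym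
      ... | no p≢t   = p , Xp , p≢s , p≢t

      -- X ∖ {s} would be a nontrivial module of σ[X].
      no-uniform-vertex : ∀ {s} → X s →
        (∀ {x x'} → X x → X x' → x ≢ s → x' ≢ s → [ s , x ]≅[ s , x' ]) → ⊥
      no-uniform-vertex {s} Xs uniform with proj₂ prime-X (λ x → X x × x ≢ s)
          ((λ _ → proj₁) , λ x y v (Xx , x≢s) (Xy , y≢s) Xv v∉ →
            subst (λ w → [ x , w ]≅[ y , w ]) (sym (em⇒dne em (v∉ ∘ (Xv ,_))))
                  (≅-flip (uniform Xx Xy x≢s y≢s)))
      ... | inj₁ empty =
        let (p , _ , Xp , _ , _ , p≢s , _) = two-others s in empty p (Xp , p≢s)
      ... | inj₂ (inj₁ whole) = proj₂ (whole s Xs) refl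
      ... | inj₂ (inj₂ (_ , point)) =
        let (p , q , Xp , Xq , p≢q , p≢s , q≢s) = two-others s
        in p≢q (trans (to (point p) (Xp , p≢s)) (sym (to (point q) (Xq , q≢s))))

      -- {s, t} would be a nontrivial module of σ[X].
      no-twins : ∀ {s t} → X s → X t → s ≢ t →
        (∀ {x} → X x → x ≢ s → x ≢ t → [ s , x ]≅[ t , x ]) → ⊥
      no-twins {s} {t} Xs Xt s≢t twins with proj₂ prime-X (λ x → x ≡ s ⊎ x ≡ t) pair-module
        where
        pair-module : IsModule σ X (λ x → x ≡ s ⊎ x ≡ t)
        pair-module = (λ { _ (inj₁ refl) → Xs ; _ (inj₂ refl) → Xt }) , λ
          { _ _ _ (inj₁ refl) (inj₁ refl) Xv v∉ → ≅-refl (v∉ ∘ inj₁ ∘ sym)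
          ; _ _ _ (inj₁ refl) (inj₂ refl) Xv v∉ → twins Xv (v∉ ∘ inj₁) (v∉ ∘ inj₂)
          ; _ _ _ (inj₂ refl) (inj₁ refl) Xv v∉ → ≅-sym (twins Xv (v∉ ∘ inj₁) (v∉ ∘ inj₂))
          ; _ _ _ (inj₂ refl) (inj₂ refl) Xv v∉ → ≅-refl (v∉ ∘ inj₂ ∘ sym) }
      ... | inj₁ empty = empty s (inj₁ refl)
      ... | inj₂ (inj₁ whole) =
        let (v , Xv , v≢s , v≢t) = third-point s t
        in Sum.[ v≢s , v≢t ] (whole v Xv)
      ... | inj₂ (inj₂ (_ , point)) =
        s≢t (trans (to (point s) (inj₁ refl)) (sym (to (point t) (inj₂ refl))))

  module ThreePointExtension (X : Sub V) (y₁ y₂ y₃ : V) where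

    W : Sub V
    W w = X w ⊎ (w ≡ y₁ ⊎ (w ≡ y₂ ⊎ w ≡ y₃))

    whole : ∀ {M} → (∀ {x} → X x → M x) → M y₁ → M y₂ → M y₃ → Trivial σ W M
    whole {M} X⊆M M₁ M₂ M₃ = inj₂ (inj₁ λ _ → present)
      where
      present : ∀ {x} → W x → M x
      present (inj₁ Xx)                 = X⊆M Xx
      present (inj₂ (inj₁ refl))        = M₁
      present (inj₂ (inj₂ (inj₁ refl))) = M₂
      present (inj₂ (inj₂ (inj₂ refl))) = M₃

    module _ {M : Sub V} (M-module : IsModule σ W M) where

      empty : (∀ {x} → X x → ¬ M x) → ¬ M y₁ → ¬ M y₂ → ¬ M y₃ → Trivial σ W M
      empty X∩M≡∅ ∉₁ ∉₂ ∉₃ = inj₁ λ x Mx → absent (proj₁ M-module x Mx) Mx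
        where
        absent : ∀ {x} → W x → ¬ M x
        absent (inj₁ Xx)                 = X∩M≡∅ Xx
        absent (inj₂ (inj₁ refl))        = ∉₁
        absent (inj₂ (inj₂ (inj₁ refl))) = ∉₂
        absent (inj₂ (inj₂ (inj₂ refl))) = ∉₃

      singleton : ∀ {z} → M z → (∀ {x} → X x → M x → x ≡ z) →
        (M y₁ → y₁ ≡ z) → (M y₂ → y₂ ≡ z) → (M y₃ → y₃ ≡ z) → Trivial σ W M
      singleton {z} Mz on-X on₁ on₂ on₃ =
        inj₂ (inj₂ (z , λ x → mk⇔ (λ Mx → only (proj₁ M-module x Mx) Mx) λ { refl → Mz }))
        where
        only : ∀ {x} → W x → M x → x ≡ z
        only (inj₁ Xx)                 = on-X Xx
        only (inj₂ (inj₁ refl))        = on₁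
        only (inj₂ (inj₂ (inj₁ refl))) = on₂
        only (inj₂ (inj₂ (inj₂ refl))) = on₃

      disjoint-trivial : ExcludedMiddle 0ℓ → (∀ {x} → X x → ¬ M x) →
        ¬ (M y₁ × M y₃) → ¬ (M y₂ × M y₃) → ¬ (M y₁ × M y₂ × ¬ M y₃) → Trivial σ W M
      disjoint-trivial em X∩M≡∅ ¬13 ¬23 ¬12 with em {M y₁} | em {M y₂} | em {M y₃}
      ... | yes M₁ | _      | yes M₃ = ⊥-elim (¬13 (M₁ , M₃))
      ... | _      | yes M₂ | yes M₃ = ⊥-elim (¬23 (M₂ , M₃))
      ... | yes M₁ | yes M₂ | no ∉₃  = ⊥-elim (¬12 (M₁ , M₂ , ∉₃))
      ... | yes M₁ | no ∉₂  | no ∉₃  =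
        singleton M₁ (λ Xx → ⊥-elim ∘ X∩M≡∅ Xx) (λ _ → refl) (⊥-elim ∘ ∉₂) (⊥-elim ∘ ∉₃)
      ... | no ∉₁  | yes M₂ | no ∉₃  =
        singleton M₂ (λ Xx → ⊥-elim ∘ X∩M≡∅ Xx) (⊥-elim ∘ ∉₁) (λ _ → refl) (⊥-elim ∘ ∉₃)
      ... | no ∉₁  | no ∉₂  | yes M₃ =
        singleton M₃ (λ Xx → ⊥-elim ∘ X∩M≡∅ Xx) (⊥-elim ∘ ∉₁) (⊥-elim ∘ ∉₂) (λ _ → refl)
      ... | no ∉₁  | no ∉₂  | no ∉₃  = empty X∩M≡∅ ∉₁ ∉₂ ∉₃

    ∈₁ : W y₁
    ∈₁ = inj₂ (inj₁ refl)

    ∈₂ : W y₂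
    ∈₂ = inj₂ (inj₂ (inj₁ refl))

    ∈₃ : W y₃
    ∈₃ = inj₂ (inj₂ (inj₂ refl))

    refutes-S3 : S3 σ X → ¬ X y₁ → ¬ X y₂ → ¬ X y₃ → y₁ ≢ y₂ → y₁ ≢ y₃ → y₂ ≢ y₃ →
      (∀ M → IsModule σ W M → Trivial σ W M) → ⊥
    refutes-S3 s3 ∉₁ ∉₂ ∉₃ y₁≢y₂ y₁≢y₃ y₂≢y₃ trivial =
      s3 (y₁ , y₂ , y₃ , ∉₁ , ∉₂ , ∉₃ , y₁≢y₂ , y₁≢y₃ , y₂≢y₃ ,
          (y₁ , y₂ , y₃ , ∈₁ , ∈₂ , ∈₃ , y₁≢y₂ , y₁≢y₃ , y₂≢y₃) , trivial)

  -- From a separating relation on Y to the shape of σ[Y]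

  record Separator (Y : Sub V) (b : V) : Set₁ where
    field
      _⊏_       : V → V → Set
      ⊏-connex  : ∀ {y y'} → Y y → Y y' → y ≢ y' → y ⊏ y' ⊎ y' ⊏ y
      ⊏-cotrans : ∀ {u w} → u ⊏ w → ∀ v → u ⊏ v ⊎ v ⊏ w
      ⊏⇒≅       : ∀ {y y'} → Y y → Y y' → y ⊏ y' → [ y' , y ]≅[ y' , b ]
      ≇⇒⊏       : ∀ {y y'} → Y y → Y y' → ¬ [ y , b ]≅[ y' , b ] → y ⊏ y'

  module Ordering (em : ExcludedMiddle 0ℓ) {Y : Sub V} {b : V} (S : Separator Y b)
                  {a : V} (Ya : Y a) where
    open Separator S

    _<_ : V → V → Set
    u < w = [ u , w ]≅[ a , b ]

    type-of : ∀ {w} → Y w → [ w , b ]≅[ a , b ] ⊎ [ w , b ]≅[ b , a ]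
    type-of {w} Yw with em {[ w , b ]≅[ a , b ]}
    ... | yes same = inj₁ same
    ... | no other = inj₂ (≅-sym (⊏⇒≅ Ya Yw (≇⇒⊏ Ya Yw (other ∘ ≅-sym)))
                          ∙ ≅-flip (⊏⇒≅ Yw Ya (≇⇒⊏ Yw Ya other)))

    ⊏⇒< : ∀ {u w} → Y u → Y w → u ⊏ w →
      ([ w , b ]≅[ a , b ] → w < u) × ([ w , b ]≅[ b , a ] → u < w)
    ⊏⇒< Yu Yw u⊏w = (λ t → ⊏⇒≅ Yu Yw u⊏w ∙ t) , (λ t → ≅-flip (⊏⇒≅ Yu Yw u⊏w ∙ t))

    <-connex : ∀ {u w} → Y u → Y w → u ≢ w → u < w ⊎ w < u
    <-connex Yu Yw u≢w with ⊏-connex Yu Yw u≢w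
    ... | inj₁ u⊏w = let (forward , backward) = ⊏⇒< Yu Yw u⊏w in
                     Sum.swap (Sum.map forward backward (type-of Yw))
    ... | inj₂ w⊏u = let (forward , backward) = ⊏⇒< Yw Yu w⊏u in
                     Sum.map forward backward (type-of Yu)

    symmetric⇒complete : [ a , b ]≅[ b , a ] → ∀ {u w} → Y u → Y w → u ≢ w → u < w
    symmetric⇒complete ab≅ba Yu Yw u≢w with <-connex Yu Yw u≢w
    ... | inj₁ u<w = u<w
    ... | inj₂ w<u = ≅-flip w<u ∙ ≅-sym ab≅ba

    module Asymmetric (ab≇ba : ¬ [ a , b ]≅[ b , a ]) where

      <-asym : ∀ {u w} → u < w → w < u → ⊥
      <-asym u<w w<u = ab≇ba (≅-sym u<w ∙ ≅-flip w<u)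

      Forward : V → Set
      Forward w = [ w , b ]≅[ a , b ]

      backward : ∀ {w} → Y w → ¬ Forward w → [ w , b ]≅[ b , a ]
      backward Yw ¬F = Sum.[ ⊥-elim ∘ ¬F , (λ t → t) ] (type-of Yw)

      forward-below-backward : ∀ {y y'} → Y y → Y y' → Forward y → ¬ Forward y' → y < y'
      forward-below-backward Yy Yy' Fy ¬Fy' =
        proj₂ (⊏⇒< Yy Yy' (≇⇒⊏ Yy Yy' (λ same → ¬Fy' (≅-sym same ∙ Fy)))) (backward Yy' ¬Fy')

      no-backward-to-forward : ∀ {x y} → Y x → Y y → ¬ Forward x → Forward y → x < y → ⊥
      no-backward-to-forward Yx Yy ¬Fx Fy x<y = <-asym x<y (forward-below-backward Yy Yx Fy ¬Fx)

      forward-reverses-⊏ : ∀ {u w} → Y u → Y w → Forward w → u < w → ¬ u ⊏ w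
      forward-reverses-⊏ Yu Yw Fw u<w u⊏w = <-asym u<w (proj₁ (⊏⇒< Yu Yw u⊏w) Fw)

      backward-follows-⊏ : ∀ {u w} → Y u → Y w → ¬ Forward u → u < w → ¬ w ⊏ u
      backward-follows-⊏ Yu Yw ¬Fu u<w w⊏u = <-asym u<w (proj₂ (⊏⇒< Yw Yu w⊏u) (backward Yu ¬Fu))

      no-cycle : ∀ {u v w} → Y u → Y v → Y w → u < v → v < w → w < u → ⊥
      no-cycle {u} {v} {w} Yu Yv Yw u<v v<w w<u with em {Forward u} | em {Forward v} | em {Forward w}
      ... | yes Fu | yes Fv | yes Fw = Sum.[
            (λ u⊏w → Sum.[ forward-reverses-⊏ Yu Yv Fv u<v , forward-reverses-⊏ Yv Yw Fw v<w ]
                            (⊏-cotrans u⊏w v)) ,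
            forward-reverses-⊏ Yw Yu Fu w<u ] (⊏-connex Yu Yw u≢w)
        where u≢w = ≅-distinct (≅-flip w<u)
      ... | no ¬Fu | no ¬Fv | no ¬Fw = Sum.[
            backward-follows-⊏ Yw Yu ¬Fw w<u ,
            (λ w⊏u → Sum.[ backward-follows-⊏ Yv Yw ¬Fv v<w , backward-follows-⊏ Yu Yv ¬Fu u<v ]
                            (⊏-cotrans w⊏u v)) ]
            (⊏-connex Yu Yw u≢w)
        where u≢w = ≅-distinct (≅-flip w<u)
      ... | yes Fu | yes _  | no ¬Fw = no-backward-to-forward Yw Yu ¬Fw Fu w<u
      ... | yes _  | no ¬Fv | yes Fw = no-backward-to-forward Yv Yw ¬Fv Fw v<w
      ... | yes Fu | no _   | no ¬Fw = no-backward-to-forward Yw Yu ¬Fw Fu w<u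
      ... | no ¬Fu | yes Fv | _      = no-backward-to-forward Yu Yv ¬Fu Fv u<v
      ... | no _   | no ¬Fv | yes Fw = no-backward-to-forward Yv Yw ¬Fv Fw v<w

      <-strictLinear : StrictLinearOn σ Y _<_
      <-strictLinear = (λ _ _ u<u → ≅-distinct u<u refl) , <-trans , λ _ _ → <-connex
        where
        <-trans : ∀ u v w → Y u → Y v → Y w → u < v → v < w → u < w
        <-trans u v w Yu Yv Yw u<v v<w with em {u ≡ w}
        ... | yes refl = ⊥-elim (<-asym u<v v<w)
        ... | no u≢w   =
          Sum.[ (λ u<w → u<w) , ⊥-elim ∘ no-cycle Yu Yv Yw u<v v<w ] (<-connex Yu Yw u≢w)

  module Conclusions (em : ExcludedMiddle 0ℓ) {Y : Sub V} {b : V} (S : Separator Y b)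
                     {a a' : V} (Ya : Y a) (Ya' : Y a') (a≢a' : a ≢ a') where
    open Ordering em S Ya

    constant : ∀ {e} → IsClass σ (full σ) e → e a b → e b a → Constant σ Y × ClassesAre₁ σ Y e
    constant e-class eab eba = constant-of-class Ya Ya' a≢a' e-class λ Yu Yw u≢w →
      class-closed e-class eab (proj₁ (symmetric⇒complete ab≅ba Yu Yw u≢w))
      where
      ab≅ba : [ a , b ]≅[ b , a ]
      ab≅ba = class-R e-class eba eab , class-R e-class eab eba

    module _ {e f : Rel₂ V} (e-class : IsClass σ (full σ) e) (f-class : IsClass σ (full σ) f)
             (e≢f : ¬ Same σ e f) (eab : e a b) (fba : f b a) where
      open Asymmetric (λ ab≅ba → e≢f (sharing-a-pair⇒Same e-class f-class
                                         (class-closed e-class eab (proj₂ ab≅ba)) fba))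

      private
        <⇒ef : ∀ {u w} → u < w → e u w × f w u
        <⇒ef u<w = class-closed e-class eab (proj₁ u<w) , class-closed f-class fba (proj₂ u<w)

        linear-via : ∀ {p q} → Y p → Y q → p < q → Linear σ Y × ClassesAre₂ σ Y e f
        linear-via Yp Yq p<q =
          order⇒linear e-class f-class e≢f <-strictLinear <⇒ef
            (λ euw fwu → class-R e-class eab euw , class-R f-class fba fwu) Yp Yq p<q ,
          two-classes Yp Yq (≅-distinct p<q) e-class f-class (proj₁ (<⇒ef p<q)) (proj₂ (<⇒ef p<q))
            λ Yu Yw u≢w → Sum.map (proj₁ ∘ <⇒ef) (proj₂ ∘ <⇒ef) (<-connex Yu Yw u≢w)

      linear : Linear σ Y × ClassesAre₂ σ Y e f
      linear = Sum.[ linear-via Ya Ya' , linear-via Ya' Ya ] (<-connex Ya Ya' a≢a')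

  -- y ▹ d says that d is linked to y; the hypothesis resolve is where (S3) enters.
  module Separation
    (em : ExcludedMiddle 0ℓ) (prime-V : Prime σ (full σ))
    {X Y : Sub V} {b : V} (Xb : X b) (Y⊆∁X : ∀ {y} → Y y → ¬ X y)
    (_▹_ : V → V → Set)
    (resolve : ∀ {y y' d} → Y y → Y y' → y ≢ y' → ¬ X d × ¬ Y d → ¬ y ▹ d →
                 ([ y , b ]≅[ y' , b ] × [ d , y ]≅[ d , y' ]) ⊎ (y' ▹ y × y' ▹ d))
    (transfer : ∀ {y y' d} → [ y , b ]≅[ y' , b ] → [ d , y ]≅[ d , y' ] → y' ▹ d → y ▹ d)
    (agree-on-X : ∀ {y y' v} → Y y → Y y' → [ y , b ]≅[ y' , b ] → X v → [ y , v ]≅[ y' , v ])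
    (agree-right : ∀ {y y' v} → [ y , b ]≅[ y' , b ] → y ▹ v → y' ▹ v → [ y , v ]≅[ y' , v ])
    (agree-left : ∀ {y y' v} → [ y , b ]≅[ y' , b ] → v ▹ y → v ▹ y' → [ y , v ]≅[ y' , v ])
    where

    dne : {P : Set} → ¬ ¬ P → P
    dne = em⇒dne em

    Outside : Sub V
    Outside d = ¬ X d × ¬ Y d

    classify : ∀ v → X v ⊎ Y v ⊎ Outside v
    classify v with em {X v} | em {Y v}
    ... | yes Xv | _      = inj₁ Xv
    ... | no _   | yes Yv = inj₂ (inj₁ Yv)
    ... | no ∉X  | no ∉Y  = inj₂ (inj₂ (∉X , ∉Y))

    Saturated : Sub V
    Saturated g = Y g × (∀ {d} → Outside d → g ▹ d)

    unsaturated-witness : ∀ {y} → Y y → ¬ Saturated y → ∃ λ d → Outside d × ¬ y ▹ d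
    unsaturated-witness Yy ¬sat =
      dne λ none → ¬sat (Yy , λ {d} out → dne λ ¬y▹d → none (d , out , ¬y▹d))

    saturated-▹ : ∀ {g x} → Saturated g → Y x → ¬ Saturated x → g ▹ x
    saturated-▹ {g} {x} sat@(Yg , g▹out) Yx ¬sat
      with unsaturated-witness Yx ¬sat
    ... | (d , out , ¬x▹d) with resolve Yx Yg (λ { refl → ¬sat sat }) out ¬x▹d
    ...   | inj₁ (x≅g , dx≅dg) = ⊥-elim (¬x▹d (transfer x≅g dx≅dg (g▹out out)))
    ...   | inj₂ (g▹x , _)     = g▹x

    module _ (unsaturated : ∀ {y} → Y y → ¬ Saturated y) where

      _⊏_ : V → V → Set
      y ⊏ y' = ∃ λ d → Outside d × ¬ y ▹ d × y' ▹ d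

      ⊏⇒▹ : ∀ {y y'} → Y y → Y y' → y ⊏ y' → y' ▹ y
      ⊏⇒▹ Yy Yy' (d , out , ¬y▹d , y'▹d) with resolve Yy Yy' (λ { refl → ¬y▹d y'▹d }) out ¬y▹d
      ... | inj₁ (y≅y' , dy≅dy') = ⊥-elim (¬y▹d (transfer y≅y' dy≅dy' y'▹d))
      ... | inj₂ (y'▹y , _)      = y'▹y

      unlinked-pair : ∀ {y y' d} → Y y → Y y' → y ≢ y' → Outside d → ¬ y ▹ d → ¬ y' ▹ d →
        [ y , b ]≅[ y' , b ] × [ d , y ]≅[ d , y' ]
      unlinked-pair Yy Yy' y≢y' out ¬y▹d ¬y'▹d =
        Sum.[ (λ same → same) , ⊥-elim ∘ ¬y'▹d ∘ proj₂ ] (resolve Yy Yy' y≢y' out ¬y▹d)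

      ≇⇒⊏ : ∀ {y y'} → Y y → Y y' → ¬ [ y , b ]≅[ y' , b ] → y ⊏ y'
      ≇⇒⊏ {y} {y'} Yy Yy' y≇y' with unsaturated-witness Yy (unsaturated Yy)
      ... | (d , out , ¬y▹d) with em {y' ▹ d} | em {y ≡ y'}
      ...   | yes y'▹d | _        = d , out , ¬y▹d , y'▹d
      ...   | no _     | yes refl = ⊥-elim (y≇y' (≅-refl (λ { refl → Y⊆∁X Yy Xb })))
      ...   | no ¬y'▹d | no y≢y'  = ⊥-elim (y≇y' (proj₁ (unlinked-pair Yy Yy' y≢y' out ¬y▹d ¬y'▹d)))

      ⊏-cotrans : ∀ {u w} → u ⊏ w → ∀ v → u ⊏ v ⊎ v ⊏ w
      ⊏-cotrans (d , out , ¬u▹d , w▹d) v with em {v ▹ d}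
      ... | yes v▹d = inj₁ (d , out , ¬u▹d , v▹d)
      ... | no ¬v▹d = inj₂ (d , out , ¬v▹d , w▹d)

      Twin : V → Sub V
      Twin y m = Y m × ¬ m ⊏ y × ¬ y ⊏ m

      module _ {y : V} (Yy : Y y) where

        twin-unlinked : ∀ {m d} → Twin y m → Outside d → ¬ y ▹ d → ¬ m ▹ d
        twin-unlinked (_ , _ , ¬y⊏m) out ¬y▹d m▹d = ¬y⊏m (_ , out , ¬y▹d , m▹d)

        twin-linked : ∀ {m d} → Twin y m → Outside d → y ▹ d → m ▹ d
        twin-linked (_ , ¬m⊏y , _) out y▹d = dne λ ¬m▹d → ¬m⊏y (_ , out , ¬m▹d , y▹d)

        twin-type : ∀ {m} → Twin y m → [ m , b ]≅[ y , b ]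
        twin-type {m} twin with em {m ≡ y}
        ... | yes refl = ≅-refl (λ { refl → Y⊆∁X Yy Xb })
        ... | no m≢y   =
          let (d , out , ¬y▹d) = unsaturated-witness Yy (unsaturated Yy)
          in proj₁ (unlinked-pair (proj₁ twin) Yy m≢y out (twin-unlinked twin out ¬y▹d) ¬y▹d)

        module _ {x x' : V} (tx : Twin y x) (tx' : Twin y x') where

          private
            x≅x' : [ x , b ]≅[ x' , b ]
            x≅x' = twin-type tx ∙ ≅-sym (twin-type tx')

          twins-agree-outside : ∀ {v} → Outside v → [ x , v ]≅[ x' , v ]
          twins-agree-outside {v} out with em {y ▹ v} | em {x ≡ x'}
          ... | yes y▹v | _        = agree-right x≅x' (twin-linked tx out y▹v) (twin-linked tx' out y▹v)
          ... | no _    | yes refl = ≅-refl (λ { refl → proj₂ out (proj₁ tx) })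
          ... | no ¬y▹v | no x≢x'  = ≅-flip (proj₂ (unlinked-pair (proj₁ tx) (proj₁ tx') x≢x' out
                                       (twin-unlinked tx out ¬y▹v) (twin-unlinked tx' out ¬y▹v)))

          twins-agree-on-Y : ∀ {v} → Y v → ¬ Twin y v → [ x , v ]≅[ x' , v ]
          twins-agree-on-Y {v} Yv not-twin with em {y ⊏ v} | em {v ⊏ y}
          ... | yes (d , out , ¬y▹d , v▹d) | _ =
            agree-left x≅x' (⊏⇒▹ (proj₁ tx) Yv (d , out , twin-unlinked tx out ¬y▹d , v▹d))
                            (⊏⇒▹ (proj₁ tx') Yv (d , out , twin-unlinked tx' out ¬y▹d , v▹d))
          ... | no _ | yes (d , out , ¬v▹d , y▹d) =
            agree-right x≅x' (⊏⇒▹ Yv (proj₁ tx) (d , out , ¬v▹d , twin-linked tx out y▹d))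
                             (⊏⇒▹ Yv (proj₁ tx') (d , out , ¬v▹d , twin-linked tx' out y▹d))
          ... | no ¬y⊏v | no ¬v⊏y = ⊥-elim (not-twin (Yv , ¬v⊏y , ¬y⊏v))

          twins-agree : ∀ {v} → ¬ Twin y v → [ x , v ]≅[ x' , v ]
          twins-agree {v} not-twin =
            Sum.[ agree-on-X (proj₁ tx) (proj₁ tx') x≅x' ,
                  Sum.[ (λ Yv → twins-agree-on-Y Yv not-twin) , twins-agree-outside ] ] (classify v)

      ⊏-connex : ∀ {y y'} → Y y → Y y' → y ≢ y' → y ⊏ y' ⊎ y' ⊏ y
      ⊏-connex {y} {y'} Yy Yy' y≢y' with em {y ⊏ y'} | em {y' ⊏ y}
      ... | yes y⊏y' | _        = inj₁ y⊏y'
      ... | no _     | yes y'⊏y = inj₂ y'⊏y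
      ... | no y⋢y'  | no y'⋢y  =
        ⊥-elim (prime⇒no-proper-module prime-V (Twin y) (λ tx tx' → twins-agree Yy tx tx')
                  (Yy , irrefl , irrefl) (Yy' , y'⋢y , y⋢y') y≢y' (λ (Yb , _) → Y⊆∁X Yb Xb))
        where
        irrefl : ¬ y ⊏ y
        irrefl (_ , _ , ¬y▹d , y▹d) = ¬y▹d y▹d

      separator : (∀ {y y'} → y' ▹ y → [ y' , y ]≅[ y' , b ]) → Separator Y b
      separator ▹⇒≅ = record
        { _⊏_ = _⊏_ ; ⊏-connex = ⊏-connex ; ⊏-cotrans = ⊏-cotrans
        ; ⊏⇒≅ = λ Yy Yy' → ▹⇒≅ ∘ ⊏⇒▹ Yy Yy' ; ≇⇒⊏ = ≇⇒⊏ }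

      reversed-separator : (∀ {y y'} → y ▹ y' → [ y' , y ]≅[ y' , b ]) → Separator Y b
      reversed-separator ▹⇒≅ = record
        { _⊏_ = λ y y' → y' ⊏ y
        ; ⊏-connex = λ Yy Yy' y≢y' → Sum.swap (⊏-connex Yy Yy' y≢y')
        ; ⊏-cotrans = λ u⊐w v → Sum.swap (⊏-cotrans u⊐w v)
        ; ⊏⇒≅ = λ Yy Yy' → ▹⇒≅ ∘ ⊏⇒▹ Yy' Yy
        ; ≇⇒⊏ = λ Yy Yy' y≇y' → ≇⇒⊏ Yy' Yy (y≇y' ∘ ≅-sym) }

  -- Y = ⟨X⟩

  module ExtAnalysis (em : ExcludedMiddle 0ℓ) (prime-V : Prime σ (full σ))
                     {X : Sub V} (prime-X : Prime σ X) (s3 : S3 σ X) {b : V} (Xb : X b) where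
    open PrimeRestriction prime-X

    Y : Sub V
    Y = Ext σ X

    _▹_ : V → V → Set
    u ▹ w = [ u , w ]≅[ u , b ]

    ext-uniform : ∀ {y β β'} → Y y → X β → X β' → [ y , β ]≅[ y , β' ]
    ext-uniform (∉X , _ , uniform) Xβ Xβ' = ≅-flip (uniform _ _ _ Xβ Xβ' (inj₂ refl) ∉X)

    ext-intro : ∀ {d} → ¬ X d → (∀ {β β'} → X β → X β' → [ d , β ]≅[ d , β' ]) → Y d
    ext-intro ∉X uniform = ∉X , (λ _ → inj₁) , λ
      { _ _ _ _ _ (inj₁ Xv) v∉ → ⊥-elim (v∉ Xv)
      ; _ _ _ Xx Xz (inj₂ refl) _ → ≅-flip (uniform Xx Xz) }

    module Obstruction {y y' d : V} (Yy : Y y) (Yy' : Y y') (y≢y' : y ≢ y')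
      (∉X : ¬ X d) (∉Y : ¬ Y d) (¬y▹d : ¬ y ▹ d)
      (¬A : ¬ ([ y , b ]≅[ y' , b ] × [ d , y ]≅[ d , y' ]))
      (¬B : ¬ (y' ▹ y × y' ▹ d)) where
      open ThreePointExtension X y y' d

      module _ {M : Sub V} (M-module : IsModule σ W M) where

        private
          uniform : ∀ {x x' v} → M x → M x' → W v → ¬ M v → [ x , v ]≅[ x' , v ]
          uniform = proj₂ M-module _ _ _

          through : (∀ {x} → X x → ¬ M x) → ∀ {z} → Y z → M d → M z →
            ∀ {β β'} → X β → X β' → [ d , β ]≅[ d , β' ]
          through X∩M≡∅ Yz Md Mz Xβ Xβ' = uniform Md Mz (inj₁ Xβ) (X∩M≡∅ Xβ) ∙ ext-uniform Yz Xβ Xβ'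
                                          ∙ uniform Mz Md (inj₁ Xβ') (X∩M≡∅ Xβ')

          around : ∀ {s} → M s → (∀ {x} → X x → M x → x ≡ s) → ∀ {z} → Y z → M z →
            ∀ {x x'} → X x → X x' → x ≢ s → x' ≢ s → [ s , x ]≅[ s , x' ]
          around Ms only-s Yz Mz Xx Xx' x≢s x'≢s =
            uniform Ms Mz (inj₁ Xx) (x≢s ∘ only-s Xx) ∙ ext-uniform Yz Xx Xx'
            ∙ uniform Mz Ms (inj₁ Xx') (x'≢s ∘ only-s Xx')

        when-covering : (∀ {x} → X x → M x) → Trivial σ W M
        when-covering X⊆M with em {M d} | em {M y} | em {M y'}
        ... | no d∉ | _ | _ =
          ⊥-elim (∉Y (ext-intro ∉X λ Xβ Xβ' → ≅-flip (uniform (X⊆M Xβ) (X⊆M Xβ') ∈₃ d∉)))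
        ... | yes Md | no y∉ | _ = ⊥-elim (¬y▹d (≅-flip (uniform Md (X⊆M Xb) ∈₁ y∉)))
        ... | yes Md | yes My | no y'∉ =
          ⊥-elim (¬B (≅-flip (uniform My (X⊆M Xb) ∈₂ y'∉) , ≅-flip (uniform Md (X⊆M Xb) ∈₂ y'∉)))
        ... | yes Md | yes My | yes My' = whole X⊆M My My' Md

        when-disjoint : (∀ {x} → X x → ¬ M x) → Trivial σ W M
        when-disjoint X∩M≡∅ = disjoint-trivial M-module em X∩M≡∅
          (λ (My , Md) → ∉Y (ext-intro ∉X (through X∩M≡∅ Yy Md My)))
          (λ (My' , Md) → ∉Y (ext-intro ∉X (through X∩M≡∅ Yy' Md My')))
          (λ (My , My' , d∉) →
             ¬A (uniform My My' (inj₁ Xb) (X∩M≡∅ Xb) , ≅-flip (uniform My My' ∈₃ d∉)))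

        when-meeting : ∀ {s} → X s → M s → (∀ {x} → X x → M x → x ≡ s) → Trivial σ W M
        when-meeting {s} Xs Ms only-s with em {M y} | em {M y'} | em {M d}
        ... | yes My | _ | _ = ⊥-elim (no-uniform-vertex em Xs (around Ms only-s Yy My))
        ... | no _ | yes My' | _ = ⊥-elim (no-uniform-vertex em Xs (around Ms only-s Yy' My'))
        ... | no y∉ | no _ | yes Md = ⊥-elim (¬y▹d (≅-flip (uniform Md Ms ∈₁ y∉) ∙ ext-uniform Yy Xs Xb))
        ... | no y∉ | no y'∉ | no d∉ =
          singleton M-module Ms only-s (⊥-elim ∘ y∉) (⊥-elim ∘ y'∉) (⊥-elim ∘ d∉)

      all-trivial : ∀ M → IsModule σ W M → Trivial σ W M
      all-trivial M M-module with trace inj₁ M-module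
      ... | disjoint X∩M≡∅       = when-disjoint M-module X∩M≡∅
      ... | covers X⊆M           = when-covering M-module X⊆M
      ... | meets-at Xs Ms only-s = when-meeting M-module Xs Ms only-s

      impossible : ⊥
      impossible = refutes-S3 s3 (proj₁ Yy) (proj₁ Yy') ∉X y≢y'
                     (λ { refl → ∉Y Yy }) (λ { refl → ∉Y Yy' }) all-trivial

    resolve : ∀ {y y' d} → Y y → Y y' → y ≢ y' → ¬ X d × ¬ Y d → ¬ y ▹ d →
      ([ y , b ]≅[ y' , b ] × [ d , y ]≅[ d , y' ]) ⊎ (y' ▹ y × y' ▹ d)
    resolve {y} {y'} {d} Yy Yy' y≢y' (∉X , ∉Y) ¬y▹d
      with em {[ y , b ]≅[ y' , b ] × [ d , y ]≅[ d , y' ]} | em {y' ▹ y × y' ▹ d}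
    ... | yes A | _     = inj₁ A
    ... | no _  | yes B = inj₂ B
    ... | no ¬A | no ¬B = ⊥-elim (Obstruction.impossible Yy Yy' y≢y' ∉X ∉Y ¬y▹d ¬A ¬B)

    module Sep = Separation em prime-V Xb proj₁ _▹_ resolve
      (λ y≅y' dy≅dy' y'▹d → ≅-flip dy≅dy' ∙ y'▹d ∙ ≅-sym y≅y')
      (λ Yy Yy' y≅y' Xv → ext-uniform Yy Xv Xb ∙ y≅y' ∙ ext-uniform Yy' Xb Xv)
      (λ y≅y' y▹v y'▹v → y▹v ∙ y≅y' ∙ ≅-sym y'▹v)
      (λ _ v▹y v▹y' → ≅-flip (v▹y ∙ ≅-sym v▹y'))
    open Sep using (Saturated)

    -- Otherwise the unsaturated vertices would form a proper module of σ.
    unsaturated : ∀ {y} → Y y → ¬ Saturated y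
    unsaturated Yy sat-y =
      let (p , q , _ , Xp , Xq , _ , p≢q , _) = proj₁ prime-X
      in prime⇒no-proper-module prime-V (¬_ ∘ Saturated) uniform
           (λ sat → proj₁ (proj₁ sat) Xp) (λ sat → proj₁ (proj₁ sat) Xq) p≢q (λ ¬sat → ¬sat sat-y)
      where
      ▹-unsaturated : ∀ {g x} → Saturated g → ¬ Saturated x → g ▹ x
      ▹-unsaturated {x = x} sat ¬sat with Sep.classify x
      ... | inj₁ Xx          = ext-uniform (proj₁ sat) Xx Xb
      ... | inj₂ (inj₁ Yx)   = Sep.saturated-▹ sat Yx ¬sat
      ... | inj₂ (inj₂ out)  = proj₂ sat out
      uniform : ∀ {x x' v} → ¬ Saturated x → ¬ Saturated x' → ¬ ¬ Saturated v → [ x , v ]≅[ x' , v ]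
      uniform ¬sat ¬sat' ¬¬sat = let sat = em⇒dne em ¬¬sat in
        ≅-flip (▹-unsaturated sat ¬sat ∙ ≅-sym (▹-unsaturated sat ¬sat'))

    separator : Separator Y b
    separator = Sep.separator unsaturated (λ y'▹y → y'▹y)

  -- Y = X(α)

  module XAtAnalysis (em : ExcludedMiddle 0ℓ) (prime-V : Prime σ (full σ))
                     {X : Sub V} (prime-X : Prime σ X) (s3 : S3 σ X) {α : V} (Xα : X α) where
    open PrimeRestriction prime-X

    Y : Sub V
    Y = XAt σ X α

    _▹_ : V → V → Set
    u ▹ w = [ w , u ]≅[ w , α ]

    xat-view : ∀ {y β} → Y y → X β → β ≢ α → [ α , β ]≅[ y , β ]
    xat-view (∉X , _ , uniform) Xβ β≢α = uniform _ _ _ (inj₁ refl) (inj₂ refl) (inj₁ Xβ)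
      λ { (inj₁ β≡α) → β≢α β≡α ; (inj₂ refl) → ∉X Xβ }

    xat-intro : ∀ {d} → ¬ X d → (∀ {β} → X β → β ≢ α → [ α , β ]≅[ d , β ]) → Y d
    xat-intro ∉X twin = ∉X , (λ { _ (inj₁ refl) → inj₁ Xα ; _ (inj₂ refl) → inj₂ refl }) , λ
      { _ _ _ _           _           (inj₂ refl) v∉ → ⊥-elim (v∉ (inj₂ refl))
      ; _ _ _ (inj₁ refl) (inj₁ refl) (inj₁ _)    v∉ → ≅-refl (v∉ ∘ inj₁ ∘ sym)
      ; _ _ _ (inj₁ refl) (inj₂ refl) (inj₁ Xv)   v∉ → twin Xv (v∉ ∘ inj₁)
      ; _ _ _ (inj₂ refl) (inj₁ refl) (inj₁ Xv)   v∉ → ≅-sym (twin Xv (v∉ ∘ inj₁))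
      ; _ _ _ (inj₂ refl) (inj₂ refl) (inj₁ _)    v∉ → ≅-refl (v∉ ∘ inj₂ ∘ sym) }

    not-uniform : ∀ {y} → Y y → ¬ (∀ {β β'} → X β → X β' → [ y , β ]≅[ y , β' ])
    not-uniform Yy uniform = no-uniform-vertex em Xα λ Xx Xx' x≢α x'≢α →
      xat-view Yy Xx x≢α ∙ uniform Xx Xx' ∙ ≅-sym (xat-view Yy Xx' x'≢α)

    module Obstruction {y y' d : V} (Yy : Y y) (Yy' : Y y') (y≢y' : y ≢ y')
      (∉X : ¬ X d) (∉Y : ¬ Y d) (¬y▹d : ¬ y ▹ d)
      (¬A : ¬ ([ y , α ]≅[ y' , α ] × [ d , y ]≅[ d , y' ]))
      (¬B : ¬ (y' ▹ y × y' ▹ d)) where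
      open ThreePointExtension X y y' d

      module _ {M : Sub V} (M-module : IsModule σ W M) where

        private
          uniform : ∀ {x x' v} → M x → M x' → W v → ¬ M v → [ x , v ]≅[ x' , v ]
          uniform = proj₂ M-module _ _ _

          through : (∀ {x} → X x → ¬ M x) → ∀ {z} → Y z → M z → M d →
            ∀ {β} → X β → β ≢ α → [ α , β ]≅[ d , β ]
          through X∩M≡∅ Yz Mz Md Xβ β≢α = xat-view Yz Xβ β≢α ∙ uniform Mz Md (inj₁ Xβ) (X∩M≡∅ Xβ)

          twin-of-α : ∀ {s} → M s → (∀ {x} → X x → M x → x ≡ s) → ∀ {z} → Y z → M z →
            ∀ {x} → X x → x ≢ s → x ≢ α → [ s , x ]≅[ α , x ]
          twin-of-α Ms only-s Yz Mz Xx x≢s x≢α =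
            uniform Ms Mz (inj₁ Xx) (x≢s ∘ only-s Xx) ∙ ≅-sym (xat-view Yz Xx x≢α)

        when-covering : (∀ {x} → X x → M x) → Trivial σ W M
        when-covering X⊆M with em {M y} | em {M y'} | em {M d}
        ... | no y∉ | _ | _ =
          ⊥-elim (not-uniform Yy λ Xβ Xβ' → ≅-flip (uniform (X⊆M Xβ) (X⊆M Xβ') ∈₁ y∉))
        ... | yes _ | no y'∉ | _ =
          ⊥-elim (not-uniform Yy' λ Xβ Xβ' → ≅-flip (uniform (X⊆M Xβ) (X⊆M Xβ') ∈₂ y'∉))
        ... | yes My | yes _ | no d∉ = ⊥-elim (¬y▹d (≅-flip (uniform My (X⊆M Xα) ∈₃ d∉)))
        ... | yes My | yes My' | yes Md = whole X⊆M My My' Md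

        when-disjoint : (∀ {x} → X x → ¬ M x) → Trivial σ W M
        when-disjoint X∩M≡∅ = disjoint-trivial M-module em X∩M≡∅
          (λ (My , Md) → ∉Y (xat-intro ∉X (through X∩M≡∅ Yy My Md)))
          (λ (My' , Md) → ∉Y (xat-intro ∉X (through X∩M≡∅ Yy' My' Md)))
          (λ (My , My' , d∉) →
             ¬A (uniform My My' (inj₁ Xα) (X∩M≡∅ Xα) , ≅-flip (uniform My My' ∈₃ d∉)))

        when-meeting-at-α : M α → (∀ {x} → X x → M x → x ≡ α) → Trivial σ W M
        when-meeting-at-α Mα only-α with em {M d} | em {M y} | em {M y'}
        ... | yes Md | _ | _ =
          ⊥-elim (∉Y (xat-intro ∉X λ Xβ β≢α → uniform Mα Md (inj₁ Xβ) (β≢α ∘ only-α Xβ)))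
        ... | no d∉ | yes My | _ = ⊥-elim (¬y▹d (≅-flip (uniform My Mα ∈₃ d∉)))
        ... | no d∉ | no y∉ | yes My' =
          ⊥-elim (¬B (≅-flip (uniform My' Mα ∈₁ y∉) , ≅-flip (uniform My' Mα ∈₃ d∉)))
        ... | no d∉ | no y∉ | no y'∉ =
          singleton M-module Mα only-α (⊥-elim ∘ y∉) (⊥-elim ∘ y'∉) (⊥-elim ∘ d∉)

        when-meeting-elsewhere : ∀ {s} → s ≢ α → X s → M s → (∀ {x} → X x → M x → x ≡ s) →
          Trivial σ W M
        when-meeting-elsewhere {s} s≢α Xs Ms only-s with em {M y} | em {M y'} | em {M d}
        ... | yes My | _ | _ = ⊥-elim (no-twins em Xs Xα s≢α (twin-of-α Ms only-s Yy My))
        ... | no _ | yes My' | _ = ⊥-elim (no-twins em Xs Xα s≢α (twin-of-α Ms only-s Yy' My'))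
        ... | no y∉ | no _ | yes Md =
          ⊥-elim (¬y▹d (uniform Md Ms ∈₁ y∉ ∙ ≅-sym (≅-flip (xat-view Yy Xs s≢α))
                        ∙ ≅-sym (uniform Md Ms (inj₁ Xα) (s≢α ∘ sym ∘ only-s Xα))))
        ... | no y∉ | no y'∉ | no d∉ =
          singleton M-module Ms only-s (⊥-elim ∘ y∉) (⊥-elim ∘ y'∉) (⊥-elim ∘ d∉)

      all-trivial : ∀ M → IsModule σ W M → Trivial σ W M
      all-trivial M M-module with trace inj₁ M-module
      ... | disjoint X∩M≡∅ = when-disjoint M-module X∩M≡∅
      ... | covers X⊆M     = when-covering M-module X⊆M
      ... | meets-at {s} Xs Ms only-s with em {s ≡ α}
      ...   | yes refl = when-meeting-at-α M-module Ms only-s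
      ...   | no s≢α   = when-meeting-elsewhere M-module s≢α Xs Ms only-s

      impossible : ⊥
      impossible = refutes-S3 s3 (proj₁ Yy) (proj₁ Yy') ∉X y≢y'
                     (λ { refl → ∉Y Yy }) (λ { refl → ∉Y Yy' }) all-trivial

    resolve : ∀ {y y' d} → Y y → Y y' → y ≢ y' → ¬ X d × ¬ Y d → ¬ y ▹ d →
      ([ y , α ]≅[ y' , α ] × [ d , y ]≅[ d , y' ]) ⊎ (y' ▹ y × y' ▹ d)
    resolve {y} {y'} {d} Yy Yy' y≢y' (∉X , ∉Y) ¬y▹d
      with em {[ y , α ]≅[ y' , α ] × [ d , y ]≅[ d , y' ]} | em {y' ▹ y × y' ▹ d}
    ... | yes A | _     = inj₁ A
    ... | no _  | yes B = inj₂ B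
    ... | no ¬A | no ¬B = ⊥-elim (Obstruction.impossible Yy Yy' y≢y' ∉X ∉Y ¬y▹d ¬A ¬B)

    agree-on-X : ∀ {y y' v} → Y y → Y y' → [ y , α ]≅[ y' , α ] → X v → [ y , v ]≅[ y' , v ]
    agree-on-X {v = v} Yy Yy' y≅y' Xv with em {v ≡ α}
    ... | yes refl = y≅y'
    ... | no v≢α   = ≅-sym (xat-view Yy Xv v≢α) ∙ xat-view Yy' Xv v≢α

    module Sep = Separation em prime-V Xα proj₁ _▹_ resolve
      (λ _ dy≅dy' y'▹d → dy≅dy' ∙ y'▹d)
      agree-on-X
      (λ _ y▹v y'▹v → ≅-flip (y▹v ∙ ≅-sym y'▹v))
      (λ y≅y' v▹y v▹y' → v▹y ∙ y≅y' ∙ ≅-sym v▹y')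
    open Sep using (Saturated)

    -- Otherwise α together with the saturated vertices would form a proper module of σ.
    unsaturated : ∀ {y} → Y y → ¬ Saturated y
    unsaturated {y} Yy sat-y =
      let (β , _ , Xβ , _ , _ , β≢α , _) = two-others em α
      in prime⇒no-proper-module prime-V Cluster (λ cx cx' v∉ → like-α cx v∉ ∙ ≅-sym (like-α cx' v∉))
           (inj₁ refl) (inj₂ sat-y) (λ α≡y → proj₁ Yy (subst X α≡y Xα))
           Sum.[ β≢α , (λ sat → proj₁ (proj₁ sat) Xβ) ]
      where
      Cluster : Sub V
      Cluster v = v ≡ α ⊎ Saturated v
      like-α : ∀ {x v} → Cluster x → ¬ Cluster v → [ x , v ]≅[ α , v ]
      like-α (inj₁ refl) v∉ = ≅-refl (v∉ ∘ inj₁ ∘ sym)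
      like-α {v = v} (inj₂ sat) v∉ with Sep.classify v
      ... | inj₁ Xv         = ≅-sym (xat-view (proj₁ sat) Xv (v∉ ∘ inj₁))
      ... | inj₂ (inj₁ Yv)  = ≅-flip (Sep.saturated-▹ sat Yv (v∉ ∘ inj₂))
      ... | inj₂ (inj₂ out) = ≅-flip (proj₂ sat out)

    separator : Separator Y α
    separator = Sep.reversed-separator unsaturated (λ y▹y' → y▹y')

lemma3p11 : (V : Set) (σ : TwoStructure V) (X : Sub V) →
    ¬ (∀ v → X v) → Prime σ X → S3 σ X → Prime σ (full σ) →
    ((e : Rel₂ V) → IsClass σ (full σ) e →
      ((AtLeast2 σ (ExtEF σ X e e) →
          Constant σ (Ext σ X) × ClassesAre₁ σ (Ext σ X) e) ×
       ((α : V) → X α → AtLeast2 σ (XAtEF σ X α e e) →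
          Constant σ (XAt σ X α) × ClassesAre₁ σ (XAt σ X α) e))) ×
    ((e f : Rel₂ V) → IsClass σ (full σ) e → IsClass σ (full σ) f → ¬ Same σ e f →
      ((AtLeast2 σ (ExtEF σ X e f) →
          Linear σ (Ext σ X) × ClassesAre₂ σ (Ext σ X) e f) ×
       ((α : V) → X α → AtLeast2 σ (XAtEF σ X α e f) →
          Linear σ (XAt σ X α) × ClassesAre₂ σ (XAt σ X α) e f)))
lemma3p11 V σ X _ prime-X s3 prime-V =
  (λ e e-class →
    (λ (a , a' , a≢a' , (Ya , a∼X) , (Ya' , _)) →
       OnExt.constant Ya Ya' a≢a' e-class (proj₁ (a∼X b Xb)) (proj₂ (a∼X b Xb))) ,
    (λ α Xα (a , a' , a≢a' , (Ya , eaα , eαa) , (Ya' , _)) →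
       OnXAt.constant Xα Ya Ya' a≢a' e-class eaα eαa)) ,
  (λ e f e-class f-class e≢f →
    (λ (a , a' , a≢a' , (Ya , a∼X) , (Ya' , _)) →
       OnExt.linear Ya Ya' a≢a' e-class f-class e≢f (proj₁ (a∼X b Xb)) (proj₂ (a∼X b Xb))) ,
    (λ α Xα (a , a' , a≢a' , (Ya , eaα , fαa) , (Ya' , _)) →
       OnXAt.linear Xα Ya Ya' a≢a' e-class f-class e≢f eaα fαa))
  where
  em : ExcludedMiddle 0ℓ
  em = prime⇒em σ prime-X

  b : V
  b = proj₁ (proj₁ prime-X)

  Xb : X b
  Xb = proj₁ (proj₂ (proj₂ (proj₂ (proj₁ prime-X))))

  module OnExt {a a' : V} (Ya : Ext σ X a) (Ya' : Ext σ X a') (a≢a' : a ≢ a') =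
    Conclusions σ em (ExtAnalysis.separator σ em prime-V prime-X s3 Xb) Ya Ya' a≢a'

  module OnXAt {α : V} (Xα : X α) {a a' : V} (Ya : XAt σ X α a) (Ya' : XAt σ X α a')
               (a≢a' : a ≢ a') =
    Conclusions σ em (XAtAnalysis.separator σ em prime-V prime-X s3 Xα) Ya Ya' a≢a'
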